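{- For any graph $G$ of order $n$, $$\gamma_{\rm sp}(G)\le n-\rho(L(G)).$$
   Context: All graphs are finite, simple and undirected. For a vertex $v$ of a graph $G$, $N(v)$ denotes the set of vertices adjacent to $v$ and $N[v]=N(v)\cup\{v\}$. For $D\subseteq V(G)$ write $\overline{D}=V(G)\setminus D$. A set $D\subseteq V(G)$ is a super dominating set of $G$ if for every $u\in\overline{D}$ there exists $v\in D$ such that $N(v)\cap\overline{D}=\{u\}$; the super domination number $\gamma_{\rm sp}(G)$ is the minimum cardinality of a super dominating set of $G$. The line graph $L(G)$ has the edges of $G$ as vertices, two being adjacent iff the corresponding edges of $G$ share an endpoint. A set $X$ of vertices of a graph $F$ is a $2$-packing if $N[u]\cap N[v]=\emptyset$ for all distinct $u,v\in X$; the $2$-packing number $\rho(F)$ is the maximum cardinality of a $2$-packing of $F$. -}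

module Defs where

open import Data.Nat using (ℕ; _≤_)
open import Data.Fin using (Fin; _<_)
open import Data.Fin.Subset using (Subset; _∈_; _∉_; ∣_∣)
open import Data.Bool using (Bool; true; false)
open import Data.Product using (Σ; Σ-syntax; ∃; ∃-syntax; _×_; _,_; proj₁; proj₂)
open import Data.Sum using (_⊎_)
open import Data.List using (List; length)
import Data.List.Membership.Propositional as LM
open import Data.List.Relation.Unary.Unique.Propositional using (Unique)
open import Relation.Binary.PropositionalEquality using (_≡_; _≢_)
open import Relation.Nullary using (¬_)

record SimpleGraph (n : ℕ) : Set where
  field
    adj    : Fin n → Fin n → Bool
    sym    : ∀ i j → adj i j ≡ adj j i
    irrefl : ∀ i → adj i i ≡ false

module _ {n : ℕ} (G : SimpleGraph n) where
  open SimpleGraph G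

  Adj : Fin n → Fin n → Set
  Adj i j = adj i j ≡ true

  IsSuperDominating : Subset n → Set
  IsSuperDominating D =
    ∀ u → u ∉ D →
      ∃[ v ] (v ∈ D × Adj v u × (∀ w → w ∉ D → Adj v w → w ≡ u))

  IsSuperDominationNumber : ℕ → Set
  IsSuperDominationNumber g =
    (∃[ D ] (IsSuperDominating D × ∣ D ∣ ≡ g)) ×
    (∀ D → IsSuperDominating D → g ≤ ∣ D ∣)

  -- Edges of G: pairs {i , j} stored with i < j.
  Edge : Set
  Edge = Σ[ p ∈ Fin n × Fin n ] (proj₁ p < proj₂ p × Adj (proj₁ p) (proj₂ p))

  _incident_ : Fin n → Edge → Set
  x incident ((i , j) , _) = x ≡ i ⊎ x ≡ j

  AdjL : Edge → Edge → Set
  AdjL e f = e ≢ f × ∃[ x ] (x incident e × x incident f)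

  InClosedNbhdL : Edge → Edge → Set
  InClosedNbhdL e f = f ≡ e ⊎ AdjL e f

  Is2PackingL : List Edge → Set
  Is2PackingL X =
    Unique X ×
    (∀ {e f} → e LM.∈ X → f LM.∈ X → e ≢ f →
       ¬ (∃[ h ] (InClosedNbhdL e h × InClosedNbhdL f h)))

  Is2PackingNumberL : ℕ → Set
  Is2PackingNumberL k =
    (∃[ X ] (Is2PackingL X × length X ≡ k)) ×
    (∀ X → Is2PackingL X → length X ≤ k)

module Submission where

-- Let X be a maximum 2-packing of L(G) and S the set of lower endpoints of the edges in X.
-- Distinct edges of X share no endpoint, so |S| = |X| = ρ(L(G)). The complement of S is super
-- dominating: the vertex lower(e) ∈ S is the only vertex of S adjacent to upper(e) ∉ S, for an
-- edge from upper(e) to another lower(f) would lie in N[e] ∩ N[f].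

open import Defs
open import Data.Nat using (ℕ; _≤_; _∸_; s≤s; z≤n)
open import Data.Nat.Properties using (≤-trans; ∸-monoʳ-≤; module ≤-Reasoning)
open import Data.Fin using (Fin)
open import Data.Fin.Properties using (<-cmp; <⇒≢; <-irrelevant; _≟_)
open import Data.Fin.Subset using (Subset; _∈_; _∉_; _⊂_; ∣_∣; ⁅_⁆; _∪_; ∁; ⋃)
open import Data.Fin.Subset.Properties
  using (∉⊥; x∈⁅x⁆; x∈⁅y⁆⇒x≡y; x∈p∪q⁻; x∈p∪q⁺; q⊆p∪q; p⊂q⇒∣p∣<∣q∣; ∣∁p∣≡n∸∣p∣; x∉∁p⇒x∈p; x∉p⇒x∈∁p)
import Data.Bool as Bool
open import Data.Product using (∃-syntax; _×_; _,_; proj₁; proj₂)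
open import Data.Sum using (inj₁; inj₂)
open import Data.List using (List; []; _∷_; length; map)
open import Data.List.Properties using (length-map)
open import Data.List.Membership.Propositional using () renaming (_∈_ to _∈ˡ_)
open import Data.List.Membership.Propositional.Properties using (∈-map⁻)
open import Data.List.Relation.Unary.Any using (here; there)
import Data.List.Relation.Unary.All as All
import Data.List.Relation.Unary.All.Properties as All
open import Data.List.Relation.Unary.AllPairs using ([]; _∷_)
open import Data.List.Relation.Unary.Unique.Propositional using (Unique)
open import Data.Empty using (⊥; ⊥-elim)
open import Function using (_∘_)
open import Relation.Binary.Definitions using (DecidableEquality; tri<; tri≈; tri>)
open import Relation.Binary.PropositionalEquality
open import Relation.Nullary using (yes; no)
open import Axiom.UniquenessOfIdentityProofs using (module Decidable⇒UIP)

Unique-map⁺ : ∀ {a b} {A : Set a} {B : Set b} {f : A → B} {xs : List A} →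
  (∀ {x y} → x ∈ˡ xs → y ∈ˡ xs → x ≢ y → f x ≢ f y) →
  Unique xs → Unique (map f xs)
Unique-map⁺ inj [] = []
Unique-map⁺ inj (x∉xs ∷ xs!) =
  All.map⁺ (All.tabulate λ y∈xs → inj (here refl) (there y∈xs) (All.lookup x∉xs y∈xs))
  ∷ Unique-map⁺ (λ x∈ y∈ → inj (there x∈) (there y∈)) xs!

module _ {n : ℕ} where

  fromList : List (Fin n) → Subset n
  fromList xs = ⋃ (map ⁅_⁆ xs)

  ∈fromList⁻ : ∀ {x} xs → x ∈ fromList xs → x ∈ˡ xs
  ∈fromList⁻ []       x∈ = ⊥-elim (∉⊥ x∈)
  ∈fromList⁻ (y ∷ xs) x∈ with x∈p∪q⁻ ⁅ y ⁆ (fromList xs) x∈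
  ... | inj₁ x∈⁅y⁆  = here (x∈⁅y⁆⇒x≡y y x∈⁅y⁆)
  ... | inj₂ x∈rest = there (∈fromList⁻ xs x∈rest)

  length≤∣fromList∣ : ∀ {xs} → Unique xs → length xs ≤ ∣ fromList xs ∣
  length≤∣fromList∣ {[]}     []           = z≤n
  length≤∣fromList∣ {y ∷ xs} (y∉xs ∷ xs!) =
    ≤-trans (s≤s (length≤∣fromList∣ xs!)) (p⊂q⇒∣p∣<∣q∣ rest⊂all)
    where
    rest⊂all : fromList xs ⊂ fromList (y ∷ xs)
    rest⊂all = (λ {_} → q⊆p∪q ⁅ y ⁆ (fromList xs)) , y , x∈p∪q⁺ (inj₁ (x∈⁅x⁆ y))
             , λ y∈rest → All.lookup y∉xs (∈fromList⁻ xs y∈rest) refl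

module _ {n : ℕ} (G : SimpleGraph n) where
  open SimpleGraph G using () renaming (sym to adj-sym; irrefl to adj-irrefl)

  infix 4 _∈ₑ_
  _∈ₑ_ : Fin n → Edge G → Set
  _∈ₑ_ = _incident_ G

  lower upper : Edge G → Fin n
  lower ((i , _) , _) = i
  upper ((_ , j) , _) = j

  lower∈ₑ : ∀ e → lower e ∈ₑ e
  lower∈ₑ _ = inj₁ refl

  upper∈ₑ : ∀ e → upper e ∈ₑ e
  upper∈ₑ _ = inj₂ refl

  lower≢upper : ∀ e → lower e ≢ upper e
  lower≢upper (_ , i<j , _) = <⇒≢ i<j

  Adj-sym : ∀ {x y} → Adj G x y → Adj G y x
  Adj-sym {x} {y} a = trans (adj-sym y x) a

  Adj-irrefl : ∀ {x y} → Adj G x y → x ≢ y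
  Adj-irrefl {x} a refl with trans (sym a) (adj-irrefl x)
  ... | ()

  edgeJoining : ∀ {x y} → Adj G x y → ∃[ h ] (x ∈ₑ h × y ∈ₑ h)
  edgeJoining {x} {y} a with <-cmp x y
  ... | tri< x<y _ _ = ((x , y) , x<y , a) , inj₁ refl , inj₂ refl
  ... | tri≈ _ x≡y _ = ⊥-elim (Adj-irrefl a x≡y)
  ... | tri> _ _ y<x = ((y , x) , y<x , Adj-sym a) , inj₂ refl , inj₁ refl

  -- The proof components of an edge are irrelevant, so edges are equal iff their endpoints are.
  _≟ₑ_ : DecidableEquality (Edge G)
  ((i , j) , i<j , a) ≟ₑ ((k , l) , k<l , b) with i ≟ k | j ≟ l
  ... | yes refl | yes refl = yes (cong₂ (λ p q → (i , j) , p , q)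
                                    (<-irrelevant i<j k<l) (Decidable⇒UIP.≡-irrelevant Bool._≟_ a b))
  ... | no i≢k   | _        = no (i≢k ∘ cong lower)
  ... | yes _    | no j≢l   = no (j≢l ∘ cong upper)

  ∈ₑ⇒InClosedNbhdL : ∀ {x e h} → x ∈ₑ e → x ∈ₑ h → InClosedNbhdL G e h
  ∈ₑ⇒InClosedNbhdL {x} {e} {h} x∈e x∈h with h ≟ₑ e
  ... | yes h≡e = inj₁ h≡e
  ... | no  h≢e = inj₂ (h≢e ∘ sym , x , x∈e , x∈h)

  module _ {X : List (Edge G)} (packing : Is2PackingL G X) where
    private
      closedNbhdsDisjoint : ∀ {e f} → e ∈ˡ X → f ∈ˡ X → e ≢ f →
        ∃[ h ] (InClosedNbhdL G e h × InClosedNbhdL G f h) → ⊥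
      closedNbhdsDisjoint = proj₂ packing

    noSharedEndpoint : ∀ {e f x} → e ∈ˡ X → f ∈ˡ X → e ≢ f → x ∈ₑ e → x ∈ₑ f → ⊥
    noSharedEndpoint {f = f} e∈X f∈X e≢f x∈e x∈f =
      closedNbhdsDisjoint e∈X f∈X e≢f (f , inj₂ (e≢f , _ , x∈e , x∈f) , inj₁ refl)

    noJoiningEdge : ∀ {e f x y} → e ∈ˡ X → f ∈ˡ X → e ≢ f → x ∈ₑ e → y ∈ₑ f → Adj G x y → ⊥
    noJoiningEdge e∈X f∈X e≢f x∈e y∈f a with edgeJoining a
    ... | h , x∈h , y∈h = closedNbhdsDisjoint e∈X f∈X e≢f
                            (h , ∈ₑ⇒InClosedNbhdL x∈e x∈h , ∈ₑ⇒InClosedNbhdL y∈f y∈h)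

    lowerEndpoints : Subset n
    lowerEndpoints = fromList (map lower X)

    ∈lowerEndpoints⁻ : ∀ {x} → x ∈ lowerEndpoints → ∃[ f ] (f ∈ˡ X × x ≡ lower f)
    ∈lowerEndpoints⁻ = ∈-map⁻ lower ∘ ∈fromList⁻ (map lower X)

    length≤∣lowerEndpoints∣ : length X ≤ ∣ lowerEndpoints ∣
    length≤∣lowerEndpoints∣ = subst (_≤ ∣ lowerEndpoints ∣) (length-map lower X)
      (length≤∣fromList∣ (Unique-map⁺ lowerInjective (proj₁ packing)))
      where
      lowerInjective : ∀ {e f} → e ∈ˡ X → f ∈ˡ X → e ≢ f → lower e ≢ lower f
      lowerInjective {e} e∈X f∈X e≢f le≡lf =
        noSharedEndpoint e∈X f∈X e≢f (lower∈ₑ e) (inj₁ le≡lf)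

    upper∉lowerEndpoints : ∀ {e} → e ∈ˡ X → upper e ∉ lowerEndpoints
    upper∉lowerEndpoints {e} e∈X ue∈S with ∈lowerEndpoints⁻ ue∈S
    ... | f , f∈X , ue≡lf = noSharedEndpoint e∈X f∈X e≢f (upper∈ₑ e) (inj₁ ue≡lf)
      where
      e≢f : e ≢ f
      e≢f refl = lower≢upper e (sym ue≡lf)

    ∁lowerEndpoints-isSuperDominating : IsSuperDominating G (∁ lowerEndpoints)
    ∁lowerEndpoints-isSuperDominating u u∉∁S with ∈lowerEndpoints⁻ (x∉∁p⇒x∈p u∉∁S)
    ... | e@(_ , _ , a) , e∈X , refl =
      upper e , x∉p⇒x∈∁p (upper∉lowerEndpoints e∈X) , Adj-sym a , onlyNeighbour
      where
      onlyNeighbour : ∀ w → w ∉ ∁ lowerEndpoints → Adj G (upper e) w → w ≡ lower e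
      onlyNeighbour w w∉∁S ue~w with w ≟ lower e | ∈lowerEndpoints⁻ (x∉∁p⇒x∈p w∉∁S)
      ... | yes w≡le | _              = w≡le
      ... | no  w≢le | f , f∈X , w≡lf =
        ⊥-elim (noJoiningEdge e∈X f∈X e≢f (upper∈ₑ e) (inj₁ w≡lf) ue~w)
        where
        e≢f : e ≢ f
        e≢f refl = w≢le w≡lf

theorem17 : (n : ℕ) (G : SimpleGraph n) (g k : ℕ) →
    IsSuperDominationNumber G g → Is2PackingNumberL G k → g ≤ n ∸ k
theorem17 n G g k (_ , γ-minimal) ((X , packing , |X|≡k) , _) = begin
  g                 ≤⟨ γ-minimal (∁ S) (∁lowerEndpoints-isSuperDominating G packing) ⟩
  ∣ ∁ S ∣           ≡⟨ ∣∁p∣≡n∸∣p∣ S ⟩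
  n ∸ ∣ S ∣         ≤⟨ ∸-monoʳ-≤ n (length≤∣lowerEndpoints∣ G packing) ⟩
  n ∸ length X      ≡⟨ cong (n ∸_) |X|≡k ⟩
  n ∸ k             ∎
  where
  open ≤-Reasoning
  S : Subset n
  S = lowerEndpoints G packing
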